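{- Let $x$ be a finite or infinite word on a finite alphabet $\mathcal A$ such that $F(x)$ satisfies a symmetric order condition. Then for each letter $a\in\mathcal A$, every full return word to $a$ in $F(x)$ is a palindrome.
   Context: $F(x)$ is the set of all finite factors of $x$. In $F(x)$, a word $v$ is bispecial if at least two letters $c$ have $cv\in F(x)$ and at least two letters $d$ have $vd\in F(x)$. For a pair of strict total orders $(<_A,<_D)$ on $\mathcal A$, a bispecial $v$ satisfies the order condition if whenever $cvd, c'vd'\in F(x)$ with letters $c\ne c'$, $d\ne d'$, then $c<_Ac'$ iff $d<_Dd'$; $F(x)$ satisfies the order condition if all its bispecial words (including the empty word) do. The order condition is symmetric if $<_D$ is the reverse of $<_A$. A full return word to the letter $a$ is a word in $F(x)$ that begins and ends with $a$ and contains exactly two occurrences of $a$. A palindrome is a word equal to its reverse. -}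

module Defs where

open import Data.Nat using (ℕ; zero; suc; _+_)
open import Data.Fin using (Fin; _≟_)
open import Data.List using (List; []; _∷_; _++_; [_]; reverse; filter; length)
open import Data.Product using (Σ; ∃; ∃-syntax; _×_; _,_)
open import Relation.Binary.PropositionalEquality using (_≡_; _≢_)
open import Relation.Binary.Structures using (IsStrictTotalOrder)
open import Function.Bundles using (_⇔_)

data Word (k : ℕ) : Set where
  finite   : List (Fin k) → Word k
  infinite : (ℕ → Fin k) → Word k

slice : ∀ {k} → (ℕ → Fin k) → ℕ → ℕ → List (Fin k)
slice x i zero    = []
slice x i (suc n) = x i ∷ slice x (suc i) n

data Factor {k : ℕ} : Word k → List (Fin k) → Set where
  fin-factor : ∀ (u v w : List (Fin k)) → Factor (finite (u ++ v ++ w)) v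
  inf-factor : ∀ (x : ℕ → Fin k) (i n : ℕ) → Factor (infinite x) (slice x i n)

Bispecial : ∀ {k} → Word k → List (Fin k) → Set
Bispecial x v =
  (∃[ c ] ∃[ c' ] (c ≢ c' × Factor x (c ∷ v) × Factor x (c' ∷ v))) ×
  (∃[ d ] ∃[ d' ] (d ≢ d' × Factor x (v ++ [ d ]) × Factor x (v ++ [ d' ])))

OrderConditionAt : ∀ {k} → Word k → (_<A_ _<D_ : Fin k → Fin k → Set) → List (Fin k) → Set
OrderConditionAt x _<A_ _<D_ v =
  ∀ c c' d d' → Factor x (c ∷ v ++ [ d ]) → Factor x (c' ∷ v ++ [ d' ]) →
    c ≢ c' → d ≢ d' → (c <A c') ⇔ (d <D d')

OrderCondition : ∀ {k} → Word k → (_<A_ _<D_ : Fin k → Fin k → Set) → Set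
OrderCondition x _<A_ _<D_ = ∀ v → Bispecial x v → OrderConditionAt x _<A_ _<D_ v

SymmetricOrderCondition : ∀ {k} → Word k → Set₁
SymmetricOrderCondition {k} x =
  Σ (Fin k → Fin k → Set) λ _<_ →
    IsStrictTotalOrder _≡_ _<_ × OrderCondition x _<_ (λ d d' → d' < d)

FullReturnWord : ∀ {k} → Word k → Fin k → List (Fin k) → Set
FullReturnWord x a w =
  Factor x w × (∃[ u ] w ≡ a ∷ u) × (∃[ u ] w ≡ u ++ [ a ]) × length (filter (_≟ a) w) ≡ 2

Palindrome : ∀ {A : Set} → List A → Set
Palindrome w = w ≡ reverse w

{-# OPTIONS --safe #-}
-- Write the full return word as a y a with a ∉ y, and compare words u, v through the
-- lexicographic order of u a and v a.  Cut y in two, keeping the left part reversed.  For two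
-- cuts, the stretch between the first differences on either side is a bispecial factor of a y a,
-- so the symmetric order condition says that ordering the cuts by their right parts reverses
-- their order by left parts.
-- The rank of a right part among all right parts then behaves as in the inversion of the
-- Burrows–Wheeler transform: the rank of c r determines its first letter c, and the rank of r
-- is obtained from it by a shift depending only on c and the multiset of letters of y.  Now
-- reverse y has the same letters, again reverses the order of cuts, and its whole word has the
-- same rank as y; reading both words off letter by letter gives y = reverse y.
module Submission where

open import Defs
open import Data.Empty using (⊥; ⊥-elim)
open import Data.Fin using (Fin; _≟_)
open import Data.List using (List; []; _∷_; _++_; [_]; map; length; reverse; filter; _ʳ++_)
open import Data.List.Membership.Propositional using (_∈_)
open import Data.List.Properties using (++-assoc; ++-identityʳ; ++-cancelʳ; ∷-injectiveˡ; ∷-injectiveʳ; ʳ++-defn; ʳ++-ʳ++; ++-ʳ++; reverse-++; reverse-involutive; reverse-injective; unfold-reverse; filter-accept; filter-++; length-++)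
open import Data.List.Relation.Binary.Permutation.Propositional using (_↭_; prep; ↭-sym)
open import Data.List.Relation.Binary.Permutation.Propositional.Properties using (map⁺; ↭-length; ↭-reverse)
open import Data.List.Relation.Unary.All using (All; []; _∷_)
open import Data.List.Relation.Unary.Any using (here; there)
open import Data.Nat using (ℕ; zero; suc; _+_; _∸_; _≤_; _<_; s≤s; z≤n)
open import Data.Nat.ListAction using (sum)
open import Data.Nat.ListAction.Properties using (sum-↭)
open import Data.Nat.Properties using (+-suc; +-identityʳ; +-comm; +-assoc; +-cancelˡ-≡; suc-injective; ≤-refl; m≤m+n; m≤n+m; <⇒≢; +-mono-≤; +-monoʳ-≤; +-monoʳ-<; +-mono-<-≤; +-mono-≤-<; +-commutativeSemigroup; module ≤-Reasoning)
open import Algebra.Properties.CommutativeSemigroup +-commutativeSemigroup using (interchange)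
open import Data.Product using (∃-syntax; _×_; _,_; proj₁; proj₂)
open import Data.Sum using (_⊎_; inj₁; inj₂)
open import Function using (id; _∘_)
open import Function.Bundles using (_⇔_; mk⇔; Equivalence)
open import Function.Construct.Composition using (_⇔-∘_)
open import Function.Construct.Symmetry using (⇔-sym)
open import Relation.Binary.Definitions using (tri<; tri≈; tri>)
open import Relation.Binary.PropositionalEquality using (_≡_; _≢_; refl; sym; trans; cong; cong₂; subst; module ≡-Reasoning)
open import Relation.Binary.Structures using (IsStrictTotalOrder)
open import Relation.Nullary using (¬_; Dec; yes; no; _⊎-dec_; _×-dec_; contradiction)
open import Relation.Unary using (Decidable; ∁)
open import Relation.Unary.Properties using (_∪?_)

private
  variable
    A : Set

𝟙 : {B : Set} → Dec B → ℕ
𝟙 (yes _) = 1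
𝟙 (no _)  = 0

𝟙-cong : {B C : Set} → B ⇔ C → (b : Dec B) (c : Dec C) → 𝟙 b ≡ 𝟙 c
𝟙-cong B⇔C (yes _) (yes _) = refl
𝟙-cong B⇔C (yes b) (no ¬c) = ⊥-elim (¬c (Equivalence.to B⇔C b))
𝟙-cong B⇔C (no ¬b) (yes c) = ⊥-elim (¬b (Equivalence.from B⇔C c))
𝟙-cong B⇔C (no _)  (no _)  = refl

𝟙-mono : {B C : Set} → (B → C) → (b : Dec B) (c : Dec C) → 𝟙 b ≤ 𝟙 c
𝟙-mono B⇒C (yes b) (yes _) = ≤-refl
𝟙-mono B⇒C (yes b) (no ¬c) = ⊥-elim (¬c (B⇒C b))
𝟙-mono B⇒C (no _)  _       = z≤n

count : {P : A → Set} → Decidable P → List A → ℕ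
count P? = sum ∘ map (𝟙 ∘ P?)

count-↭ : {P : A → Set} {xs ys : List A} (P? : Decidable P) → xs ↭ ys → count P? xs ≡ count P? ys
count-↭ P? p = sum-↭ (map⁺ (𝟙 ∘ P?) p)

count-cong-∈ : {P Q : A → Set} (P? : Decidable P) (Q? : Decidable Q) (xs : List A) →
               (∀ {x} → x ∈ xs → P x ⇔ Q x) → count P? xs ≡ count Q? xs
count-cong-∈ P? Q? []       _   = refl
count-cong-∈ P? Q? (x ∷ xs) P⇔Q =
  cong₂ _+_ (𝟙-cong (P⇔Q (here refl)) (P? x) (Q? x)) (count-cong-∈ P? Q? xs (P⇔Q ∘ there))

count-⊎ : {P Q : A → Set} (P? : Decidable P) (Q? : Decidable Q) → (∀ {x} → P x → ¬ Q x) →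
          (xs : List A) → count (P? ∪? Q?) xs ≡ count P? xs + count Q? xs
count-⊎ P? Q? disjoint []       = refl
count-⊎ {P = P} {Q} P? Q? disjoint (x ∷ xs) = begin
  𝟙 (P? x ⊎-dec Q? x) + count (P? ∪? Q?) xs
    ≡⟨ cong₂ _+_ (𝟙-⊎ (P? x) (Q? x)) (count-⊎ P? Q? disjoint xs) ⟩
  (𝟙 (P? x) + 𝟙 (Q? x)) + (count P? xs + count Q? xs)
    ≡⟨ interchange (𝟙 (P? x)) _ _ _ ⟩
  count P? (x ∷ xs) + count Q? (x ∷ xs) ∎
  where
  open ≡-Reasoning
  𝟙-⊎ : (p : Dec (P x)) (q : Dec (Q x)) → 𝟙 (p ⊎-dec q) ≡ 𝟙 p + 𝟙 q
  𝟙-⊎ (yes p) (yes q) = ⊥-elim (disjoint p q)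
  𝟙-⊎ (yes _) (no _)  = refl
  𝟙-⊎ (no _)  (yes _) = refl
  𝟙-⊎ (no _)  (no _)  = refl

count-mono : {P Q : A → Set} (P? : Decidable P) (Q? : Decidable Q) → (∀ {x} → P x → Q x) →
             (xs : List A) → count P? xs ≤ count Q? xs
count-mono P? Q? P⇒Q []       = z≤n
count-mono P? Q? P⇒Q (x ∷ xs) = +-mono-≤ (𝟙-mono P⇒Q (P? x) (Q? x)) (count-mono P? Q? P⇒Q xs)

count-mono-< : {P Q : A → Set} (P? : Decidable P) (Q? : Decidable Q) → (∀ {x} → P x → Q x) →
               ∀ {x xs} → x ∈ xs → Q x → ¬ P x → count P? xs < count Q? xs
count-mono-< P? Q? P⇒Q {x} {_ ∷ xs} (here refl) Qx ¬Px =
  +-mono-<-≤ (𝟙-< (P? x) (Q? x)) (count-mono P? Q? P⇒Q xs)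
  where
  𝟙-< : (p : Dec _) (q : Dec _) → 𝟙 p < 𝟙 q
  𝟙-< (yes Px) _        = ⊥-elim (¬Px Px)
  𝟙-< (no _)   (yes _)  = s≤s z≤n
  𝟙-< (no _)   (no ¬Qx) = ⊥-elim (¬Qx Qx)
count-mono-< P? Q? P⇒Q {xs = y ∷ _} (there x∈xs) Qx ¬Px =
  +-mono-≤-< (𝟙-mono P⇒Q (P? y) (Q? y)) (count-mono-< P? Q? P⇒Q x∈xs Qx ¬Px)

count-≤-∷ : {P : A → Set} (P? : Decidable P) (x : A) (xs : List A) → count P? xs ≤ count P? (x ∷ xs)
count-≤-∷ P? x xs = m≤n+m (count P? xs) (𝟙 (P? x))

All-ʳ++⁻ : {P : A → Set} (l : List A) {r : List A} → All P (l ʳ++ r) → All P l × All P r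
All-ʳ++⁻ []      Pr = [] , Pr
All-ʳ++⁻ (c ∷ l) Plcr with All-ʳ++⁻ l Plcr
... | Pl , Pc ∷ Pr = Pc ∷ Pl , Pr

ʳ++-cancelˡ : (l : List A) {r₁ r₂ : List A} → l ʳ++ r₁ ≡ l ʳ++ r₂ → r₁ ≡ r₂
ʳ++-cancelˡ []      eq = eq
ʳ++-cancelˡ (c ∷ l) eq = ∷-injectiveʳ (ʳ++-cancelˡ l eq)

ʳ++-cancelʳ : (l₁ l₂ r : List A) → l₁ ʳ++ r ≡ l₂ ʳ++ r → l₁ ≡ l₂
ʳ++-cancelʳ l₁ l₂ r eq =
  reverse-injective (++-cancelʳ r (reverse l₁) (reverse l₂) (trans (sym (ʳ++-defn l₁)) (trans eq (ʳ++-defn l₂))))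

ʳ++-++ : (l r z : List A) → l ʳ++ r ++ z ≡ (l ʳ++ r) ++ z
ʳ++-++ []      r z = refl
ʳ++-++ (c ∷ l) r z = ʳ++-++ l (c ∷ r) z

length-filter-accept : {P : A → Set} (P? : Decidable P) {x : A} {xs : List A} →
                       P x → length (filter P? (x ∷ xs)) ≡ suc (length (filter P? xs))
length-filter-accept P? Px = cong length (filter-accept P? Px)

length-filter≡0⇒All∁ : {P : A → Set} (P? : Decidable P) (xs : List A) →
                       length (filter P? xs) ≡ 0 → All (∁ P) xs
length-filter≡0⇒All∁ P? []       _  = []
length-filter≡0⇒All∁ P? (x ∷ xs) eq with P? x
... | yes _  = contradiction eq λ ()
... | no ¬Px = ¬Px ∷ length-filter≡0⇒All∁ P? xs eq

palindrome-border : (a : A) {y : List A} → Palindrome y → Palindrome (a ∷ y ++ [ a ])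
palindrome-border a {y} y-pal = begin
  a ∷ y ++ [ a ]                 ≡⟨ cong (λ z → a ∷ z ++ [ a ]) y-pal ⟩
  a ∷ reverse y ++ [ a ]         ≡⟨ cong (_++ [ a ]) (reverse-++ y [ a ]) ⟨
  reverse (y ++ [ a ]) ++ [ a ]  ≡⟨ unfold-reverse a (y ++ [ a ]) ⟨
  reverse (a ∷ y ++ [ a ])       ∎
  where open ≡-Reasoning

slice-prefix : ∀ {k} (x : ℕ → Fin k) i n u w → slice x i n ≡ u ++ w → u ≡ slice x i (length u)
slice-prefix x i n       []      w eq = refl
slice-prefix x i zero    (_ ∷ _) w ()
slice-prefix x i (suc n) (e ∷ u) w eq =
  cong₂ _∷_ (sym (∷-injectiveˡ eq)) (slice-prefix x (suc i) n u w (∷-injectiveʳ eq))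

slice-suffix : ∀ {k} (x : ℕ → Fin k) i n u w → slice x i n ≡ u ++ w →
               w ≡ slice x (length u + i) (n ∸ length u)
slice-suffix x i n       []      w eq = sym eq
slice-suffix x i zero    (_ ∷ _) w ()
slice-suffix x i (suc n) (e ∷ u) w eq =
  subst (λ j → w ≡ slice x j (n ∸ length u)) (+-suc (length u) i)
        (slice-suffix x (suc i) n u w (∷-injectiveʳ eq))

Factor-infix : ∀ {k} {x : Word k} {u} → Factor x u → ∀ p q r → u ≡ p ++ q ++ r → Factor x q
Factor-infix (fin-factor u _ w) p q r refl =
  subst (λ z → Factor (finite z) q) ++-reassoc (fin-factor (u ++ p) q (r ++ w))
  where
  open ≡-Reasoning
  ++-reassoc : (u ++ p) ++ q ++ r ++ w ≡ u ++ (p ++ q ++ r) ++ w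
  ++-reassoc = begin
    (u ++ p) ++ q ++ r ++ w   ≡⟨ ++-assoc u p _ ⟩
    u ++ p ++ q ++ r ++ w     ≡⟨ cong (λ z → u ++ p ++ z) (++-assoc q r w) ⟨
    u ++ p ++ (q ++ r) ++ w   ≡⟨ cong (u ++_) (++-assoc p (q ++ r) w) ⟨
    u ++ (p ++ q ++ r) ++ w   ∎
Factor-infix (inf-factor x i n) p q r eq =
  subst (Factor (infinite x)) (sym q-slice) (inf-factor x (length p + i) (length q))
  where
  q-slice : q ≡ slice x (length p + i) (length q)
  q-slice = slice-prefix x _ (n ∸ length p) q r (sym (slice-suffix x i n p (q ++ r) eq))

Factor-prefix : ∀ {k} {x : Word k} u w → Factor x (u ++ w) → Factor x u
Factor-prefix u w f = Factor-infix f [] u w refl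

Factor-suffix : ∀ {k} {x : Word k} u w → Factor x (u ++ w) → Factor x w
Factor-suffix u w f = Factor-infix f u w [] (cong (u ++_) (sym (++-identityʳ w)))

extensions⇒bispecial : ∀ {k} {x : Word k} {c c' d d' v} → c ≢ c' → d ≢ d' →
                       Factor x (c ∷ v ++ [ d ]) → Factor x (c' ∷ v ++ [ d' ]) → Bispecial x v
extensions⇒bispecial {c = c} {c'} {d} {d'} {v} c≢c' d≢d' f f' =
  (c , c' , c≢c' , Factor-prefix (c ∷ v) [ d ] f , Factor-prefix (c' ∷ v) [ d' ] f') ,
  (d , d' , d≢d' , Factor-suffix [ c ] (v ++ [ d ]) f , Factor-suffix [ c' ] (v ++ [ d' ]) f')

module SplitOrder {k : ℕ} {_≺_ : Fin k → Fin k → Set} (≺-sto : IsStrictTotalOrder _≡_ _≺_) (a : Fin k) where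
  open IsStrictTotalOrder ≺-sto using (compare; irrefl) renaming (_<?_ to _≺?_; trans to ≺-trans)

  Str : Set
  Str = List (Fin k)

  infix 4 _⊏_ _⊏?_

  -- The lexicographic order of u a and v a, when a occurs in neither u nor v.
  _⊏_ : Str → Str → Set
  []      ⊏ []      = ⊥
  []      ⊏ (d ∷ v) = a ≺ d
  (c ∷ u) ⊏ []      = c ≺ a
  (c ∷ u) ⊏ (d ∷ v) = c ≺ d ⊎ (c ≡ d × u ⊏ v)

  _⊏?_ : ∀ u v → Dec (u ⊏ v)
  []      ⊏? []      = no λ ()
  []      ⊏? (d ∷ v) = a ≺? d
  (c ∷ u) ⊏? []      = c ≺? a
  (c ∷ u) ⊏? (d ∷ v) = c ≺? d ⊎-dec (c ≟ d ×-dec u ⊏? v)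

  ⊏-irrefl : ∀ u → ¬ u ⊏ u
  ⊏-irrefl (c ∷ u) (inj₁ c≺c)      = irrefl refl c≺c
  ⊏-irrefl (c ∷ u) (inj₂ (_ , u⊏u)) = ⊏-irrefl u u⊏u

  head⁺ : Str → Fin k
  head⁺ []      = a
  head⁺ (e ∷ _) = e

  tail⁺ : Str → Str
  tail⁺ []      = []
  tail⁺ (_ ∷ u) = u ++ [ a ]

  ++-[a] : ∀ u → u ++ [ a ] ≡ head⁺ u ∷ tail⁺ u
  ++-[a] []      = refl
  ++-[a] (_ ∷ _) = refl

  a∷-ʳ++ : ∀ u w → a ∷ u ʳ++ w ≡ tail⁺ u ʳ++ head⁺ u ∷ w
  a∷-ʳ++ []      w = refl
  a∷-ʳ++ (e ∷ u) w = sym (++-ʳ++ u {[ a ]} {e ∷ w})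

  ⊏-++ : ∀ p {u v} → p ++ u ⊏ p ++ v ⇔ u ⊏ v
  ⊏-++ []      = mk⇔ id id
  ⊏-++ (e ∷ p) = mk⇔ to (λ u⊏v → inj₂ (refl , Equivalence.from (⊏-++ p) u⊏v))
    where
    to : ∀ {u v} → e ∷ p ++ u ⊏ e ∷ p ++ v → u ⊏ v
    to (inj₁ e≺e)         = ⊥-elim (irrefl refl e≺e)
    to (inj₂ (_ , pu⊏pv)) = Equivalence.to (⊏-++ p) pu⊏pv

  ⊏-head : ∀ {u v} → head⁺ u ≢ head⁺ v → u ⊏ v ⇔ head⁺ u ≺ head⁺ v
  ⊏-head {[]}    {[]}    a≢a = ⊥-elim (a≢a refl)
  ⊏-head {[]}    {_ ∷ _} _   = mk⇔ id id
  ⊏-head {_ ∷ _} {[]}    _   = mk⇔ id id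
  ⊏-head {_ ∷ _} {_ ∷ _} c≢d =
    mk⇔ (λ { (inj₁ c≺d) → c≺d ; (inj₂ (c≡d , _)) → ⊥-elim (c≢d c≡d) }) inj₁

  data Divergence : Str → Str → Set where
    diverge : ∀ p {s₁ s₂} → head⁺ s₁ ≢ head⁺ s₂ → Divergence (p ++ s₁) (p ++ s₂)

  divergence? : ∀ {u v} → All (_≢ a) u → All (_≢ a) v → u ≡ v ⊎ Divergence u v
  divergence? []          []           = inj₁ refl
  divergence? []          (e≢a ∷ _)    = inj₂ (diverge [] (e≢a ∘ sym))
  divergence? (e≢a ∷ _)   []           = inj₂ (diverge [] e≢a)
  divergence? {e ∷ _} {e' ∷ _} (_ ∷ a∉u) (_ ∷ a∉v) with e ≟ e' | divergence? a∉u a∉v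
  ... | no e≢e' | _                     = inj₂ (diverge [] e≢e')
  ... | yes refl | inj₁ refl            = inj₁ refl
  ... | yes refl | inj₂ (diverge p s≢s) = inj₂ (diverge (e ∷ p) s≢s)

  ⊏-divergence : ∀ p {s₁ s₂} → head⁺ s₁ ≢ head⁺ s₂ → p ++ s₁ ⊏ p ++ s₂ ⇔ head⁺ s₁ ≺ head⁺ s₂
  ⊏-divergence p {s₁} {s₂} s₁≢s₂ = ⊏-head {s₁} {s₂} s₁≢s₂ ⇔-∘ ⊏-++ p

  ⊏-irrefl-⇔ : ∀ l r → r ⊏ r ⇔ l ⊏ l
  ⊏-irrefl-⇔ l r = mk⇔ (⊥-elim ∘ ⊏-irrefl r) (⊥-elim ∘ ⊏-irrefl l)

  -- The cuts of l ʳ++ r at or after the end of l, each with its left part stored reversed.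
  splits : Str → Str → List (Str × Str)
  splits l []      = [ (l , []) ]
  splits l (c ∷ r) = (l , c ∷ r) ∷ splits (c ∷ l) r

  occurrences : Str → Str → List (Str × Fin k × Str)
  occurrences l []      = []
  occurrences l (c ∷ r) = (l , c , r) ∷ occurrences (c ∷ l) r

  splits-whole : ∀ l r → (l , r) ∈ splits l r
  splits-whole l []      = here refl
  splits-whole l (c ∷ r) = here refl

  splits-sound : ∀ l r {l' r'} → (l' , r') ∈ splits l r → l' ʳ++ r' ≡ l ʳ++ r
  splits-sound l []      (here refl) = refl
  splits-sound l (c ∷ r) (here refl) = refl
  splits-sound l (c ∷ r) (there m)   = splits-sound (c ∷ l) r m

  occurrences-sound : ∀ l r {l' c r'} → (l' , c , r') ∈ occurrences l r → l' ʳ++ c ∷ r' ≡ l ʳ++ r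
  occurrences-sound l (c ∷ r) (here refl) = refl
  occurrences-sound l (c ∷ r) (there m)   = occurrences-sound (c ∷ l) r m

  splits-step : ∀ {l r l' c r'} → (l' , c ∷ r') ∈ splits l r →
                (l' , c , r') ∈ occurrences l r × (c ∷ l' , r') ∈ splits l r
  splits-step {r = []}    (here ())
  splits-step {r = []}    (there ())
  splits-step {r = c ∷ r} (here refl) = here refl , there (splits-whole (c ∷ _) r)
  splits-step {r = c ∷ r} (there m)   = let o , s = splits-step m in there o , there s

  count-splits-left : ∀ {P : Str → Set} (P? : Decidable P) l r →
    count (λ s → P? (proj₁ s)) (splits l r) ≡
    𝟙 (P? l) + count (λ (l' , c , _) → P? (c ∷ l')) (occurrences l r)
  count-splits-left P? l []      = refl
  count-splits-left P? l (c ∷ r) = cong (𝟙 (P? l) +_) (count-splits-left P? (c ∷ l) r)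

  count-splits-right : ∀ {P : Str → Set} (P? : Decidable P) l r →
    count (λ s → P? (proj₂ s)) (splits l r) ≡
    count (λ (_ , c , r') → P? (c ∷ r')) (occurrences l r) + 𝟙 (P? [])
  count-splits-right P? l []      = +-identityʳ (𝟙 (P? []))
  count-splits-right P? l (c ∷ r) =
    trans (cong (𝟙 (P? (c ∷ r)) +_) (count-splits-right P? (c ∷ l) r))
          (sym (+-assoc (𝟙 (P? (c ∷ r))) _ _))

  count-letters : ∀ {P : Fin k → Set} (P? : Decidable P) l r →
    count (λ (_ , c , _) → P? c) (occurrences l r) ≡ count P? r
  count-letters P? l []      = refl
  count-letters P? l (c ∷ r) = cong (𝟙 (P? c) +_) (count-letters P? (c ∷ l) r)

  SplitOrderReversing : Str → Set
  SplitOrderReversing y = ∀ l₁ r₁ l₂ r₂ → l₁ ʳ++ r₁ ≡ y → l₂ ʳ++ r₂ ≡ y → r₁ ⊏ r₂ ⇔ l₂ ⊏ l₁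

  reverse-reversing : ∀ {y} → SplitOrderReversing y → SplitOrderReversing (reverse y)
  reverse-reversing {y} rev l₁ r₁ l₂ r₂ e₁ e₂ =
    ⇔-sym (rev r₂ l₂ r₁ l₁ (swap-split l₂ r₂ e₂) (swap-split l₁ r₁ e₁))
    where
    open ≡-Reasoning
    swap-split : ∀ l r → l ʳ++ r ≡ reverse y → r ʳ++ l ≡ y
    swap-split l r e = begin
      r ʳ++ l              ≡⟨ cong (r ʳ++_) (++-identityʳ l) ⟨
      r ʳ++ l ++ []        ≡⟨ ʳ++-ʳ++ l ⟨
      reverse (l ʳ++ r)    ≡⟨ cong reverse e ⟩
      reverse (reverse y)  ≡⟨ reverse-involutive y ⟩
      y                    ∎

  rank : Str → Str → ℕ
  rank y r = count (λ s → proj₂ s ⊏? r) (splits [] y)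

  blockRank : Str → Fin k → Str → ℕ
  blockRank y c r = count (λ (_ , c' , r') → c' ≟ c ×-dec r' ⊏? r) (occurrences [] y)

  -- The extra letter a accounts for the empty right part, which compares with c ∷ r as a with c.
  below above : Str → Fin k → ℕ
  below y c = count (_≺? c) (a ∷ y)
  above y c = count (c ≺?_) (a ∷ y)

  multiplicity : Str → Fin k → ℕ
  multiplicity y c = count (_≟ c) y

  rank-cons : ∀ y c r → rank y (c ∷ r) ≡ below y c + blockRank y c r
  rank-cons y c r = begin
    rank y (c ∷ r)
      ≡⟨ count-splits-right (_⊏? c ∷ r) [] y ⟩
    count (λ (_ , c' , r') → c' ∷ r' ⊏? c ∷ r) (occurrences [] y) + 𝟙 (a ≺? c)
      ≡⟨ cong (_+ 𝟙 (a ≺? c)) (count-⊎ _ _ (λ c'≺c (c'≡c , _) → irrefl c'≡c c'≺c) (occurrences [] y)) ⟩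
    count (λ (_ , c' , _) → c' ≺? c) (occurrences [] y) + blockRank y c r + 𝟙 (a ≺? c)
      ≡⟨ cong (λ n → n + blockRank y c r + 𝟙 (a ≺? c)) (count-letters (_≺? c) [] y) ⟩
    count (_≺? c) y + blockRank y c r + 𝟙 (a ≺? c)
      ≡⟨ +-comm _ (𝟙 (a ≺? c)) ⟩
    𝟙 (a ≺? c) + (count (_≺? c) y + blockRank y c r)
      ≡⟨ +-assoc (𝟙 (a ≺? c)) _ _ ⟨
    below y c + blockRank y c r ∎
    where open ≡-Reasoning

  blockRank<multiplicity : ∀ {y l c r} → (l , c , r) ∈ occurrences [] y →
                           blockRank y c r < multiplicity y c
  blockRank<multiplicity {y} {c = c} {r} o =
    subst (blockRank y c r <_) (count-letters (_≟ c) [] y)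
      (count-mono-< _ (λ (_ , c' , _) → c' ≟ c) proj₁ o refl (λ (_ , r⊏r) → ⊏-irrefl r r⊏r))

  below+multiplicity≤below : ∀ y {c c'} → c ≺ c' → below y c + multiplicity y c ≤ below y c'
  below+multiplicity≤below y {c} {c'} c≺c' = begin
    below y c + multiplicity y c        ≤⟨ +-monoʳ-≤ (below y c) (count-≤-∷ (_≟ c) a y) ⟩
    below y c + count (_≟ c) (a ∷ y)    ≡⟨ count-⊎ (_≺? c) (_≟ c) (λ e≺c e≡c → irrefl e≡c e≺c) (a ∷ y) ⟨
    count ((_≺? c) ∪? (_≟ c)) (a ∷ y)   ≤⟨ count-mono _ (_≺? c') ≼c⇒≺c' (a ∷ y) ⟩
    below y c'                          ∎
    where
    open ≤-Reasoning
    ≼c⇒≺c' : ∀ {e} → e ≺ c ⊎ e ≡ c → e ≺ c'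
    ≼c⇒≺c' (inj₁ e≺c) = ≺-trans e≺c c≺c'
    ≼c⇒≺c' (inj₂ refl) = c≺c'

  blocks-ordered : ∀ y {c c' m m'} → c ≺ c' → m < multiplicity y c → below y c + m < below y c' + m'
  blocks-ordered y {c} {c'} {m} {m'} c≺c' m<mult = begin-strict
    below y c + m                 <⟨ +-monoʳ-< (below y c) m<mult ⟩
    below y c + multiplicity y c  ≤⟨ below+multiplicity≤below y c≺c' ⟩
    below y c'                    ≤⟨ m≤m+n (below y c') m' ⟩
    below y c' + m'               ∎
    where open ≤-Reasoning

  block-injective : ∀ y {c c' m m'} → below y c + m ≡ below y c' + m' →
                    m < multiplicity y c → m' < multiplicity y c' → c ≡ c'
  block-injective y {c} {c'} eq m<mult m'<mult with compare c c'
  ... | tri< c≺c' _ _ = contradiction eq (<⇒≢ (blocks-ordered y c≺c' m<mult))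
  ... | tri≈ _ c≡c' _ = c≡c'
  ... | tri> _ _ c'≺c = contradiction (sym eq) (<⇒≢ (blocks-ordered y c'≺c m'<mult))

  module _ {y} (rev : SplitOrderReversing y) where

    ⊏-splits : ∀ l r → l ʳ++ r ≡ y → ∀ {s} → s ∈ splits [] y → proj₂ s ⊏ r ⇔ l ⊏ proj₁ s
    ⊏-splits l r e {s} m = rev (proj₁ s) (proj₂ s) l r (splits-sound [] y m) e

    rank-whole : rank y y ≡ count (a ≺?_) y
    rank-whole = begin
      rank y y
        ≡⟨ count-cong-∈ _ (λ s → [] ⊏? proj₁ s) (splits [] y) (⊏-splits [] y refl) ⟩
      count (λ s → [] ⊏? proj₁ s) (splits [] y)
        ≡⟨ count-splits-left ([] ⊏?_) [] y ⟩
      count (λ (_ , c , _) → a ≺? c) (occurrences [] y)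
        ≡⟨ count-letters (a ≺?_) [] y ⟩
      count (a ≺?_) y ∎
      where open ≡-Reasoning

    ⊏-cons-left : ∀ {l c r l' c' r'} →
                  (l , c , r) ∈ occurrences [] y → (l' , c' , r') ∈ occurrences [] y →
                  c ∷ l ⊏ c' ∷ l' ⇔ (c ≺ c' ⊎ (c' ≡ c × r' ⊏ r))
    ⊏-cons-left {l} {c} {r} {l'} {c'} {r'} o o' = mk⇔ to from
      where
      r'⊏r⇔l⊏l' : c' ∷ r' ⊏ c ∷ r ⇔ l ⊏ l'
      r'⊏r⇔l⊏l' = rev l' (c' ∷ r') l (c ∷ r) (occurrences-sound [] y o') (occurrences-sound [] y o)
      to : c ∷ l ⊏ c' ∷ l' → c ≺ c' ⊎ (c' ≡ c × r' ⊏ r)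
      to (inj₁ c≺c')          = inj₁ c≺c'
      to (inj₂ (c≡c' , l⊏l')) with Equivalence.from r'⊏r⇔l⊏l' l⊏l'
      ... | inj₁ c'≺c = ⊥-elim (irrefl (sym c≡c') c'≺c)
      ... | inj₂ r'⊏r = inj₂ r'⊏r
      from : c ≺ c' ⊎ (c' ≡ c × r' ⊏ r) → c ∷ l ⊏ c' ∷ l'
      from (inj₁ c≺c')          = inj₁ c≺c'
      from (inj₂ (c'≡c , r'⊏r)) = inj₂ (sym c'≡c , Equivalence.to r'⊏r⇔l⊏l' (inj₂ (c'≡c , r'⊏r)))

    -- Right parts below r correspond to left parts above c ∷ l, counted by their first letter.
    rank-tail : ∀ {l c r} → (l , c , r) ∈ occurrences [] y → rank y r ≡ above y c + blockRank y c r
    rank-tail {l} {c} {r} o = begin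
      rank y r
        ≡⟨ count-cong-∈ _ (λ s → c ∷ l ⊏? proj₁ s) (splits [] y)
                        (⊏-splits (c ∷ l) r (occurrences-sound [] y o)) ⟩
      count (λ s → c ∷ l ⊏? proj₁ s) (splits [] y)
        ≡⟨ count-splits-left (c ∷ l ⊏?_) [] y ⟩
      𝟙 (c ≺? a) + count (λ (l' , c' , _) → c ∷ l ⊏? c' ∷ l') (occurrences [] y)
        ≡⟨ cong (𝟙 (c ≺? a) +_) (count-cong-∈ _ above-or-block (occurrences [] y) (⊏-cons-left o)) ⟩
      𝟙 (c ≺? a) + count above-or-block (occurrences [] y)
        ≡⟨ cong (𝟙 (c ≺? a) +_)
                (count-⊎ _ _ (λ c≺c' (c'≡c , _) → irrefl (sym c'≡c) c≺c') (occurrences [] y)) ⟩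
      𝟙 (c ≺? a) + (count (λ (_ , c' , _) → c ≺? c') (occurrences [] y) + blockRank y c r)
        ≡⟨ cong (λ n → 𝟙 (c ≺? a) + (n + blockRank y c r)) (count-letters (c ≺?_) [] y) ⟩
      𝟙 (c ≺? a) + (count (c ≺?_) y + blockRank y c r)
        ≡⟨ +-assoc (𝟙 (c ≺? a)) _ _ ⟨
      above y c + blockRank y c r ∎
      where
      open ≡-Reasoning
      above-or-block : ∀ (o : Str × Fin k × Str) →
                       Dec (c ≺ proj₁ (proj₂ o) ⊎ (proj₁ (proj₂ o) ≡ c × proj₂ (proj₂ o) ⊏ r))
      above-or-block = (λ (_ , c' , _) → c ≺? c') ∪? (λ (_ , c' , r') → c' ≟ c ×-dec r' ⊏? r)

  module _ {y z} (rev-y : SplitOrderReversing y) (rev-z : SplitOrderReversing z) (y↭z : y ↭ z) where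

    rank-step : ∀ {l c r l̃ c̃ r̃} → (l , c , r) ∈ occurrences [] y → (l̃ , c̃ , r̃) ∈ occurrences [] z →
                rank y (c ∷ r) ≡ rank z (c̃ ∷ r̃) → c ≡ c̃ × rank y r ≡ rank z r̃
    rank-step {c = c} {r} {c̃ = c̃} {r̃} o õ eq = c≡c̃ , tails
      where
      open ≡-Reasoning
      heads : below y c + blockRank y c r ≡ below y c̃ + blockRank z c̃ r̃
      heads = begin
        below y c + blockRank y c r    ≡⟨ rank-cons y c r ⟨
        rank y (c ∷ r)                 ≡⟨ eq ⟩
        rank z (c̃ ∷ r̃)                 ≡⟨ rank-cons z c̃ r̃ ⟩
        below z c̃ + blockRank z c̃ r̃    ≡⟨ cong (_+ blockRank z c̃ r̃) (count-↭ (_≺? c̃) (prep a (↭-sym y↭z))) ⟩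
        below y c̃ + blockRank z c̃ r̃    ∎
      c≡c̃ : c ≡ c̃
      c≡c̃ = block-injective y heads (blockRank<multiplicity o)
              (subst (blockRank z c̃ r̃ <_) (count-↭ (_≟ c̃) (↭-sym y↭z)) (blockRank<multiplicity õ))
      same-above : above y c ≡ above z c̃
      same-above = trans (cong (above y) c≡c̃) (count-↭ (c̃ ≺?_) (prep a y↭z))
      same-blockRank : blockRank y c r ≡ blockRank z c̃ r̃
      same-blockRank = +-cancelˡ-≡ (below y c) _ _ (trans heads (cong (λ d → below y d + _) (sym c≡c̃)))
      tails : rank y r ≡ rank z r̃
      tails = begin
        rank y r                       ≡⟨ rank-tail rev-y o ⟩
        above y c + blockRank y c r    ≡⟨ cong₂ _+_ same-above same-blockRank ⟩
        above z c̃ + blockRank z c̃ r̃    ≡⟨ rank-tail rev-z õ ⟨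
        rank z r̃                       ∎

    rank-injective : ∀ {l r l̃ r̃} → (l , r) ∈ splits [] y → (l̃ , r̃) ∈ splits [] z →
                     length r ≡ length r̃ → rank y r ≡ rank z r̃ → r ≡ r̃
    rank-injective {r = []}    {r̃ = []}    _ _ _  _ = refl
    rank-injective {r = []}    {r̃ = _ ∷ _} _ _ () _
    rank-injective {r = _ ∷ _} {r̃ = []}    _ _ () _
    rank-injective {r = _ ∷ _} {r̃ = _ ∷ _} s s̃ len eq =
      let o , s' = splits-step s
          õ , s̃' = splits-step s̃
          c≡c̃ , tails = rank-step o õ eq
      in cong₂ _∷_ c≡c̃ (rank-injective s' s̃' (suc-injective len) tails)

    reversing-↭⇒≡ : y ≡ z
    reversing-↭⇒≡ = rank-injective (splits-whole [] y) (splits-whole [] z) (↭-length y↭z)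
      (trans (rank-whole rev-y) (trans (count-↭ (a ≺?_) y↭z) (sym (rank-whole rev-z))))

  reversing⇒palindrome : ∀ {y} → SplitOrderReversing y → y ≡ reverse y
  reversing⇒palindrome {y} rev = reversing-↭⇒≡ rev (reverse-reversing rev) (↭-sym (↭-reverse y))

module _ {k} {x : Word k} {_≺_ : Fin k → Fin k → Set} (≺-sto : IsStrictTotalOrder _≡_ _≺_)
         (oc : OrderCondition x _≺_ (λ d d' → d' ≺ d)) {a : Fin k} {y : List (Fin k)}
         (a-y-a : Factor x (a ∷ y ++ [ a ])) (a∉y : All (_≢ a) y) where
  open SplitOrder ≺-sto a

  extension-factor : ∀ q t p s → (q ++ t) ʳ++ p ++ s ≡ y →
                     Factor x (head⁺ t ∷ (q ʳ++ p) ++ [ head⁺ s ])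
  extension-factor q t p s e =
    Factor-infix a-y-a (reverse (tail⁺ t)) (head⁺ t ∷ v ++ [ head⁺ s ]) (tail⁺ s) (begin
      a ∷ y ++ [ a ]
        ≡⟨ cong (λ z → a ∷ z ++ [ a ]) e ⟨
      a ∷ ((q ++ t) ʳ++ p ++ s) ++ [ a ]
        ≡⟨ cong (a ∷_) (ʳ++-++ (q ++ t) (p ++ s) [ a ]) ⟨
      a ∷ (q ++ t) ʳ++ (p ++ s) ++ [ a ]
        ≡⟨ cong (a ∷_) (++-ʳ++ q) ⟩
      a ∷ t ʳ++ q ʳ++ (p ++ s) ++ [ a ]
        ≡⟨ a∷-ʳ++ t _ ⟩
      tail⁺ t ʳ++ head⁺ t ∷ q ʳ++ (p ++ s) ++ [ a ]
        ≡⟨ cong (λ z → tail⁺ t ʳ++ head⁺ t ∷ q ʳ++ z) (++-assoc p s [ a ]) ⟩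
      tail⁺ t ʳ++ head⁺ t ∷ q ʳ++ p ++ s ++ [ a ]
        ≡⟨ cong (λ z → tail⁺ t ʳ++ head⁺ t ∷ z) (ʳ++-++ q p _) ⟩
      tail⁺ t ʳ++ head⁺ t ∷ v ++ s ++ [ a ]
        ≡⟨ cong (λ z → tail⁺ t ʳ++ head⁺ t ∷ v ++ z) (++-[a] s) ⟩
      tail⁺ t ʳ++ head⁺ t ∷ v ++ head⁺ s ∷ tail⁺ s
        ≡⟨ ʳ++-defn (tail⁺ t) ⟩
      reverse (tail⁺ t) ++ head⁺ t ∷ v ++ head⁺ s ∷ tail⁺ s
        ≡⟨ cong (λ z → reverse (tail⁺ t) ++ head⁺ t ∷ z) (++-assoc v [ head⁺ s ] (tail⁺ s)) ⟨
      reverse (tail⁺ t) ++ (head⁺ t ∷ v ++ [ head⁺ s ]) ++ tail⁺ s ∎)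
    where
    open ≡-Reasoning
    v : Str
    v = q ʳ++ p

  a∉split : ∀ l r → l ʳ++ r ≡ y → All (_≢ a) l × All (_≢ a) r
  a∉split l r e = All-ʳ++⁻ l (subst (All (_≢ a)) (sym e) a∉y)

  order-condition⇒reversing : SplitOrderReversing y
  order-condition⇒reversing l₁ r₁ l₂ r₂ e₁ e₂
    with divergence? (proj₁ (a∉split l₁ r₁ e₁)) (proj₁ (a∉split l₂ r₂ e₂))
       | divergence? (proj₂ (a∉split l₁ r₁ e₁)) (proj₂ (a∉split l₂ r₂ e₂))
  ... | inj₁ refl | _ =
    subst (λ r → r₁ ⊏ r ⇔ l₁ ⊏ l₁) (ʳ++-cancelˡ l₁ (trans e₁ (sym e₂))) (⊏-irrefl-⇔ l₁ r₁)
  ... | _ | inj₁ refl =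
    subst (λ l → r₁ ⊏ r₁ ⇔ l ⊏ l₁) (ʳ++-cancelʳ l₁ l₂ r₁ (trans e₁ (sym e₂))) (⊏-irrefl-⇔ l₁ r₁)
  ... | inj₂ (diverge q {t₁} {t₂} t₁≢t₂) | inj₂ (diverge p {s₁} {s₂} s₁≢s₂) =
    ⇔-sym (⊏-divergence q (t₁≢t₂ ∘ sym)) ⇔-∘ (⇔-sym heads ⇔-∘ ⊏-divergence p s₁≢s₂)
    where
    v : Str
    v = q ʳ++ p
    f₁ : Factor x (head⁺ t₁ ∷ v ++ [ head⁺ s₁ ])
    f₁ = extension-factor q t₁ p s₁ e₁
    f₂ : Factor x (head⁺ t₂ ∷ v ++ [ head⁺ s₂ ])
    f₂ = extension-factor q t₂ p s₂ e₂
    heads : head⁺ t₂ ≺ head⁺ t₁ ⇔ head⁺ s₁ ≺ head⁺ s₂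
    heads = oc v (extensions⇒bispecial {v = v} (t₁≢t₂ ∘ sym) (s₁≢s₂ ∘ sym) f₂ f₁)
               _ _ _ _ f₂ f₁ (t₁≢t₂ ∘ sym) (s₁≢s₂ ∘ sym)

full-return-shape : ∀ {k} (a : Fin k) {w} → (∃[ u ] w ≡ a ∷ u) → (∃[ u ] w ≡ u ++ [ a ]) →
                    length (filter (_≟ a) w) ≡ 2 → ∃[ y ] w ≡ a ∷ y ++ [ a ] × All (_≢ a) y
full-return-shape a (_ , refl) ([] , refl) two =
  contradiction (trans (sym (length-filter-accept (_≟ a) refl)) two) λ ()
full-return-shape a (_ , refl) (_ ∷ y , refl) two =
  y , refl , length-filter≡0⇒All∁ (_≟ a) y no-inner-a
  where
  open ≡-Reasoning
  #a : List (Fin _) → ℕ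
  #a u = length (filter (_≟ a) u)
  no-inner-a : #a y ≡ 0
  no-inner-a = suc-injective (begin
    suc (#a y)                                       ≡⟨ +-comm 1 (#a y) ⟩
    #a y + 1                                         ≡⟨ cong (#a y +_) (length-filter-accept (_≟ a) refl) ⟨
    #a y + #a [ a ]                                  ≡⟨ length-++ (filter (_≟ a) y) ⟨
    length (filter (_≟ a) y ++ filter (_≟ a) [ a ])  ≡⟨ cong length (filter-++ (_≟ a) y [ a ]) ⟨
    #a (y ++ [ a ])                                  ≡⟨ suc-injective (trans (sym (length-filter-accept (_≟ a) refl)) two) ⟩
    1                                                ∎)

lemma1 : ∀ (k : ℕ) (x : Word k) → SymmetricOrderCondition x →
    ∀ (a : Fin k) (w : List (Fin k)) → FullReturnWord x a w → Palindrome w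
lemma1 k x (_≺_ , ≺-sto , oc) a w (a-w-a , starts , ends , two)
  with full-return-shape a starts ends two
... | y , refl , a∉y = palindrome-border a y-palindrome
  where
  y-palindrome : Palindrome y
  y-palindrome = SplitOrder.reversing⇒palindrome ≺-sto a (order-condition⇒reversing ≺-sto oc a-w-a a∉y)
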